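{- Let $G=(U,W,E)$ be a convex bipartite graph with $|U|\ge 2$ and $|W|\ge 2$, with convex ordering $w_1,\dots,w_{|W|}$ of $W$, and let $D$ be a minimal connected dominating set of $G$. If $i,j\in U$ are distinct vertices with $I_i\subseteq I_j$, then $|\{i,j\}\cap D|\le 1$.
   Context: All graphs are finite, undirected, simple. A bipartite graph $G=(U,W,E)$ is convex if there is an ordering $w_1,\dots,w_{|W|}$ of $W$ such that for every $u\in U$ the neighborhood $N(u)\subseteq W$ is a set of consecutive vertices $I_u=\{w_a,w_{a+1},\dots,w_b\}$ in this ordering (the neighbor interval of $u$; $l(I_u)=w_a$ and $r(I_u)=w_b$ are its left and right endpoints). A set $D\subseteq V(G)$ is a connected dominating set if $G[D]$ is connected and every vertex of $G$ is in $D$ or has a neighbor in $D$; it is minimal if no proper subset of it is a connected dominating set. -}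

module Defs where

open import Data.Nat using (ℕ)
open import Data.Fin using (Fin; _≤_)
open import Data.Bool using (Bool; T)
open import Data.Sum using (_⊎_; inj₁; inj₂)
open import Data.Product using (_×_; ∃)
open import Data.Empty using (⊥)

Vertex : ℕ → ℕ → Set
Vertex m n = Fin m ⊎ Fin n

EdgeRel : ℕ → ℕ → Set
EdgeRel m n = Fin m → Fin n → Bool

Adj : ∀ {m n} → EdgeRel m n → Vertex m n → Vertex m n → Set
Adj E (inj₁ u) (inj₂ w) = T (E u w)
Adj E (inj₂ w) (inj₁ u) = T (E u w)
Adj E (inj₁ _) (inj₁ _) = ⊥
Adj E (inj₂ _) (inj₂ _) = ⊥

-- Convexity w.r.t. the ordering w_1 < ... < w_n given by the order of Fin n:
-- every neighbourhood N(u) is a set of consecutive vertices of W.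
Convex : ∀ {m n} → EdgeRel m n → Set
Convex {m} {n} E = ∀ (u : Fin m) (a b c : Fin n) → a ≤ c → c ≤ b →
  T (E u a) → T (E u b) → T (E u c)

VSet : ℕ → ℕ → Set
VSet m n = Vertex m n → Bool

_∈ₛ_ : ∀ {m n} → Vertex m n → VSet m n → Set
v ∈ₛ S = T (S v)

data Walk {m n} (E : EdgeRel m n) (S : VSet m n) : Vertex m n → Vertex m n → Set where
  here : ∀ {x} → x ∈ₛ S → Walk E S x x
  step : ∀ {x y z} → x ∈ₛ S → Adj E x y → Walk E S y z → Walk E S x z

InducedConnected : ∀ {m n} → EdgeRel m n → VSet m n → Set
InducedConnected E S = ∀ x y → x ∈ₛ S → y ∈ₛ S → Walk E S x y

Dominating : ∀ {m n} → EdgeRel m n → VSet m n → Set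
Dominating E S = ∀ v → v ∈ₛ S ⊎ ∃ (λ u → Adj E v u × u ∈ₛ S)

IsCDS : ∀ {m n} → EdgeRel m n → VSet m n → Set
IsCDS E S = InducedConnected E S × Dominating E S

IsMinimalCDS : ∀ {m n} → EdgeRel m n → VSet m n → Set
IsMinimalCDS E D = IsCDS E D ×
  (∀ (D' : VSet _ _) → (∀ v → v ∈ₛ D' → v ∈ₛ D) → IsCDS E D' → ∀ v → v ∈ₛ D → v ∈ₛ D')

NbhdSubset : ∀ {m n} → EdgeRel m n → Fin m → Fin m → Set
NbhdSubset E i j = ∀ w → T (E i w) → T (E j w)

-- Deleting i from D keeps it a connected dominating set: every vertex
-- dominated by i is adjacent to j ∈ D, and a walk of G[D] through i enters and
-- leaves it along edges w i and i w', which are replaced by w j and j w'. Since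
-- G[D] is connected and contains j ≠ i, i itself has a neighbour in D, which
-- cannot be i.
module Submission where

open import Defs
open import Data.Nat using (ℕ; _≥_)
open import Data.Fin using (Fin) renaming (_≟_ to _≟ᶠ_)
open import Data.Bool using (false; if_then_else_)
open import Data.Sum using (inj₁; inj₂; _⊎_)
open import Data.Sum.Properties using (≡-dec; inj₁-injective)
open import Data.Product using (_×_; _,_; ∃)
open import Data.Empty using (⊥-elim)
open import Relation.Binary.Definitions using (DecidableEquality)
open import Relation.Binary.PropositionalEquality using (_≢_; refl; sym)
open import Relation.Nullary using (¬_; does; yes; no)

_≟ᵥ_ : ∀ {m n} → DecidableEquality (Vertex m n)
_≟ᵥ_ = ≡-dec _≟ᶠ_ _≟ᶠ_

_─_ : ∀ {m n} → VSet m n → Vertex m n → VSet m n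
(S ─ x) v = if does (v ≟ᵥ x) then false else S v

module _ {m n : ℕ} (S : VSet m n) (x : Vertex m n) where

  ∈-─⁺ : ∀ {v} → v ≢ x → v ∈ₛ S → v ∈ₛ (S ─ x)
  ∈-─⁺ {v} v≢x v∈S with v ≟ᵥ x
  ... | yes v≡x = ⊥-elim (v≢x v≡x)
  ... | no _    = v∈S

  ∈-─⁻ : ∀ v → v ∈ₛ (S ─ x) → v ∈ₛ S
  ∈-─⁻ v v∈S─x with v ≟ᵥ x
  ... | no _ = v∈S─x

  ∉-─ : ¬ (x ∈ₛ (S ─ x))
  ∉-─ x∈S─x with x ≟ᵥ x
  ... | no x≢x = x≢x refl

module _ {m n : ℕ} {E : EdgeRel m n} {S : VSet m n} where

  Walk-head : ∀ {x z} → Walk E S x z → x ∈ₛ S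
  Walk-head (here x∈S)     = x∈S
  Walk-head (step x∈S _ _) = x∈S

  Walk-distinct⇒neighbour : ∀ {x z} → Walk E S x z → x ≢ z →
    ∃ (λ y → Adj E x y × y ∈ₛ S)
  Walk-distinct⇒neighbour (here _)          x≢x = ⊥-elim (x≢x refl)
  Walk-distinct⇒neighbour (step _ x~y walk) _   = _ , x~y , Walk-head walk

module RemoveDominated {m n : ℕ} {E : EdgeRel m n} {D : VSet m n} {i j : Fin m}
  (i≢j : i ≢ j) (Ni⊆Nj : NbhdSubset E i j) (j∈D : inj₁ j ∈ₛ D) where

  D⁻ : VSet m n
  D⁻ = D ─ inj₁ i

  ∈-D⁻⁺ : ∀ {v} → v ≢ inj₁ i → v ∈ₛ D → v ∈ₛ D⁻
  ∈-D⁻⁺ = ∈-─⁺ D (inj₁ i)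

  D⁻⊆D : ∀ v → v ∈ₛ D⁻ → v ∈ₛ D
  D⁻⊆D = ∈-─⁻ D (inj₁ i)

  ∉-D⁻ : ¬ (inj₁ i ∈ₛ D⁻)
  ∉-D⁻ = ∉-─ D (inj₁ i)

  j∈D⁻ : inj₁ j ∈ₛ D⁻
  j∈D⁻ = ∈-D⁻⁺ (λ j≡i → i≢j (sym (inj₁-injective j≡i))) j∈D

  reroute : ∀ {x z} → Walk E D x z → x ∈ₛ D⁻ → z ∈ₛ D⁻ → Walk E D⁻ x z
  reroute (here _) x∈D⁻ _ = here x∈D⁻
  reroute (step {y = y} _ x~y walk) x∈D⁻ z∈D⁻ with y ≟ᵥ inj₁ i
  ... | no y≢i = step x∈D⁻ x~y (reroute walk (∈-D⁻⁺ y≢i (Walk-head walk)) z∈D⁻)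
  reroute {inj₂ w} (step _ w~i (here _)) _ z∈D⁻ | yes refl = ⊥-elim (∉-D⁻ z∈D⁻)
  reroute {inj₂ w} (step _ w~i (step {y = inj₂ w′} _ i~w′ walk)) w∈D⁻ z∈D⁻ | yes refl =
    step w∈D⁻ (Ni⊆Nj w w~i)
      (step j∈D⁻ (Ni⊆Nj w′ i~w′)
        (reroute walk (∈-D⁻⁺ (λ ()) (Walk-head walk)) z∈D⁻))

  redirect : ∀ v u → Adj E v u → u ∈ₛ D → ∃ (λ u′ → Adj E v u′ × u′ ∈ₛ D⁻)
  redirect v u v~u u∈D with u ≟ᵥ inj₁ i
  ... | no u≢i = u , v~u , ∈-D⁻⁺ u≢i u∈D
  redirect (inj₂ w) _ w~i _ | yes refl = inj₁ j , Ni⊆Nj w w~i , j∈D⁻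

  isCDS : inj₁ i ∈ₛ D → IsCDS E D → IsCDS E D⁻
  isCDS i∈D (connected , dominating) = connected⁻ , dominating⁻
    where
    connected⁻ : InducedConnected E D⁻
    connected⁻ x y x∈D⁻ y∈D⁻ =
      reroute (connected x y (D⁻⊆D x x∈D⁻) (D⁻⊆D y y∈D⁻)) x∈D⁻ y∈D⁻

    dominating⁻ : Dominating E D⁻
    dominating⁻ v with v ≟ᵥ inj₁ i | dominating v
    ... | no _   | inj₁ v∈D            = inj₁ v∈D
    ... | no _   | inj₂ (u , v~u , u∈D) = inj₂ (redirect v u v~u u∈D)
    ... | yes refl | _
      with Walk-distinct⇒neighbour (connected (inj₁ i) (inj₁ j) i∈D j∈D)
             (λ i≡j → i≢j (inj₁-injective i≡j))
    ...   | u , i~u , u∈D = inj₂ (redirect (inj₁ i) u i~u u∈D)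

mainTheorem3 : ∀ (m n : ℕ) → m ≥ 2 → n ≥ 2 → (E : EdgeRel m n) → Convex E →
    (D : VSet m n) → IsMinimalCDS E D →
    (i j : Fin m) → i ≢ j → NbhdSubset E i j →
    ¬ (inj₁ i ∈ₛ D × inj₁ j ∈ₛ D)
mainTheorem3 m n _ _ E _ D (cds , minimal) i j i≢j Ni⊆Nj (i∈D , j∈D) =
  ∉-D⁻ (minimal D⁻ D⁻⊆D (isCDS i∈D cds) (inj₁ i) i∈D)
  where open RemoveDominated {D = D} i≢j Ni⊆Nj j∈D
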